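{- Let $A$ be a matrix with entries from a totally ordered set. If $A$ has a saddlepoint of value $s$, then every pseudo-saddlepoint of $A$ has value $s$.
   Context: For an $m\times n$ matrix $A=(a_{i,j})$, a saddlepoint is an entry $a_{i,j}$ with $a_{i,j} \geq a_{i,k}$ for all $k\in[n]$ and $a_{i,j}\leq a_{k,j}$ for all $k\in[m]$, i.e. a maximum of its row and a minimum of its column. A pseudo-saddlepoint is an entry $a_{i,j}=v$ such that every row of $A$ contains an entry $\geq v$ and every column of $A$ contains an entry $\leq v$. -}

module Defs where

open import Level using (Level)
open import Data.Nat using (ℕ)
open import Data.Fin using (Fin)
open import Data.Product using (∃; _×_)
open import Relation.Binary.Bundles using (TotalOrder)

Matrix : ∀ {c ℓ₁ ℓ₂} (O : TotalOrder c ℓ₁ ℓ₂) → ℕ → ℕ → Set c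
Matrix O m n = Fin m → Fin n → TotalOrder.Carrier O

module _ {c ℓ₁ ℓ₂} (O : TotalOrder c ℓ₁ ℓ₂) where
  open TotalOrder O

  IsSaddlepoint : ∀ {m n} → Matrix O m n → Fin m → Fin n → Set ℓ₂
  IsSaddlepoint {m} {n} A i j =
    (∀ (k : Fin n) → A i k ≤ A i j) × (∀ (k : Fin m) → A i j ≤ A k j)

  IsPseudoSaddlepoint : ∀ {m n} → Matrix O m n → Fin m → Fin n → Set ℓ₂
  IsPseudoSaddlepoint {m} {n} A i j =
    (∀ (r : Fin m) → ∃ λ (k : Fin n) → A i j ≤ A r k)
    × (∀ (col : Fin n) → ∃ λ (k : Fin m) → A k col ≤ A i j)

module Submission where

open import Defs
open import Data.Nat using (ℕ)
open import Data.Fin using (Fin)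
open import Data.Product using (∃; _,_)
open import Relation.Binary.Bundles using (TotalOrder)

-- The pseudo-saddlepoint value v is squeezed by the saddlepoint a i j: row i has an
-- entry ≥ v, and that entry is ≤ a i j; column j has an entry ≤ v, and it is ≥ a i j.

module _ {c ℓ₁ ℓ₂} (O : TotalOrder c ℓ₁ ℓ₂) where
  open TotalOrder O

  saddlepoint-≥-rowwise-lower-bound : ∀ {m n} {A : Matrix O m n} {i j} →
    IsSaddlepoint O A i j → ∀ {v} →
    (∀ r → ∃ λ k → v ≤ A r k) → v ≤ A i j
  saddlepoint-≥-rowwise-lower-bound {i = i} (rowMax , _) rows
    with rows i
  ... | k , v≤aik = trans v≤aik (rowMax k)

  saddlepoint-≤-columnwise-upper-bound : ∀ {m n} {A : Matrix O m n} {i j} →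
    IsSaddlepoint O A i j → ∀ {v} →
    (∀ col → ∃ λ k → A k col ≤ v) → A i j ≤ v
  saddlepoint-≤-columnwise-upper-bound {j = j} (_ , colMin) cols
    with cols j
  ... | l , alj≤v = trans (colMin l) alj≤v

lemma3 : ∀ {c ℓ₁ ℓ₂} (O : TotalOrder c ℓ₁ ℓ₂) (m n : ℕ) (A : Matrix O m n)
    (i : Fin m) (j : Fin n) → IsSaddlepoint O A i j →
    (p : Fin m) (q : Fin n) → IsPseudoSaddlepoint O A p q →
    TotalOrder._≈_ O (A p q) (A i j)
lemma3 O m n A i j saddle p q (rows , cols) =
  TotalOrder.antisym O
    (saddlepoint-≥-rowwise-lower-bound O saddle rows)
    (saddlepoint-≤-columnwise-upper-bound O saddle cols)
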